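{- For all integers $m,n,q\geq 0$, \[ (-1)^{m}\sum_{k=0}^{m+q}\binom{m+q}{k}\binom{n+q+k}{q}B_{n+k}\;-\;(-1)^{n+q}\sum_{k=0}^{n+q}\binom{n+q}{k}\binom{m+q+k}{q}B_{m+k}=0, \] where $(B_j)_{j\geq 0}$ are the Bernoulli numbers.
   Context: The Bernoulli polynomials $(B_n(x))_{n\geq 0}$ are defined by the exponential generating function $\frac{ze^{zx}}{e^{z}-1}=\sum_{n\geq 0}B_n(x)\frac{z^n}{n!}$, and the Bernoulli numbers are $B_n=B_n(0)$ for $n\geq 0$ (so $\frac{z}{e^z-1}=\sum_{n\ge 0}B_n\frac{z^n}{n!}$, in particular $B_1=-\tfrac12$). -}

module Defs where

open import Data.Nat as ℕ using (ℕ; zero; suc)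
open import Data.Nat.Combinatorics using (_C_)
open import Data.Integer using (+_)
open import Data.Rational using (ℚ; 0ℚ; 1ℚ; _+_; _*_; -_; _/_)
open import Data.Fin using (Fin; toℕ)
open import Data.Vec using (Vec; []; _∷ʳ_; lookup)

Σ≤ : ℕ → (ℕ → ℚ) → ℚ
Σ≤ zero    f = f 0
Σ≤ (suc n) f = Σ≤ n f + f (suc n)

ΣFin : ∀ {n} → (Fin n → ℚ) → ℚ
ΣFin {zero}  f = 0ℚ
ΣFin {suc n} f = f Data.Fin.zero + ΣFin (λ i → f (Data.Fin.suc i))

ι : ℕ → ℚ
ι n = + n / 1

-- table [B_0, …, B_{n-1}] of Bernoulli numbers, using the recurrence
-- equivalent to z/(e^z - 1) = Σ B_n z^n/n! :
--   B_0 = 1,  Σ_{k=0}^{n} C(n+1,k) B_k = 0  for n ≥ 1,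
-- i.e. B_n = -(1/(n+1)) Σ_{k<n} C(n+1,k) B_k.
bernNext : (n : ℕ) → Vec ℚ n → ℚ
bernNext zero    tab = 1ℚ
bernNext (suc m) tab =
  - ((+ 1 / suc (suc m)) * ΣFin (λ i → ι (suc (suc m) C toℕ i) * lookup tab i))

bernTable : (n : ℕ) → Vec ℚ n
bernTable zero    = []
bernTable (suc n) = bernTable n ∷ʳ bernNext n (bernTable n)

-- Bernoulli numbers B_n = B_n(0), with B_1 = -1/2
B : ℕ → ℚ
B n = lookup (bernTable (suc n)) (Data.Fin.fromℕ n)

sgn : ℕ → ℚ
sgn zero    = 1ℚ
sgn (suc n) = - sgn n

module Submission where

-- Write T f n = Σ_{k≤n} C(n,k) f(k) for the binomial transform of a sequence
-- f : ℕ → ℚ, and (-1)^n for sgn n.  The proof has five steps.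
--  1. Binomial inversion: Σ_{k≤n} C(n,k) (-1)^k (T f)(k) = (-1)^n f(n).
--  2. The Bernoulli numbers are the unique sequence with y₀ = 1 satisfying
--     Σ_{k≤m+1} C(m+2,k) y_k = 0 for all m.  By 1. the sequence
--     k ↦ (-1)^k (T B)(k) satisfies the same recurrence, which gives the
--     reflection formula T B n = (-1)^n B_n.
--  3. For h_q(j) = C(j,q) B_{j-q}, trinomial revision
--     C(q+r,q+j) C(q+j,q) = C(q+r,q) C(r,j) reduces T h_q to T B, so
--     T h_q a = (-1)^{a+q} h_q a.
--  4. Symmetry lemma: if T h a = (-1)^{a+p} h a for all a, then the shifted
--     transforms Ψ(a,b) = Σ_{k≤b} C(b,k) h(a+k) satisfy
--     Ψ(a,b) = (-1)^{a+b+p} Ψ(b,a), by induction on b from the Pascal rule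
--     Ψ(a,b+1) = Ψ(a,b) + Ψ(a+1,b).
--  5. The two sums of the theorem are Ψ(n+q,m+q) and Ψ(m+q,n+q) for h = h_q,
--     and 4. relates them with the sign (-1)^{n+m+3q}.

open import Defs
open import Data.Nat using (ℕ; zero; suc; z≤n; s≤s; _∸_; _!; NonZero)
  renaming (_+_ to _+ℕ_; _*_ to _*ℕ_; _≤_ to _≤ℕ_; _<_ to _<ℕ_)
import Data.Nat.Properties as ℕP
open import Data.Nat.Properties using (_!≢0; _!*_!≢0; m*n≢0)
open import Data.Nat.Combinatorics
  using (_C_; k>n⇒nCk≡0; nCk+nC[k+1]≡[n+1]C[k+1]; nCk≡nC[n∸k]; nCn≡1; nC1≡n;
         nCk≡n!/k![n-k]!; k![n∸k]!∣n!)
open import Data.Nat.DivMod using (m/n*n≡m)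
open import Agda.Builtin.Int using (pos)
import Data.Integer as ℤ
import Data.Integer.Properties as ℤP
open import Data.Rational using (ℚ; 0ℚ; 1ℚ; _+_; _*_; -_; _-_; _/_; fromℚᵘ)
import Data.Rational.Properties as ℚP
open import Data.Rational.Unnormalised as ℚᵘ using (mkℚᵘ; *≡*)
import Data.Rational.Unnormalised.Properties as ℚᵘP
open import Algebra.Properties.Group ℚP.+-0-group using (identityˡ-unique; inverseˡ-unique)
open import Data.Fin as Fin using (Fin; toℕ; fromℕ; inject₁)
import Data.Fin.Properties as FinP
open import Data.Vec using (Vec; []; _∷_; _∷ʳ_; lookup)
open import Data.Product using (Σ; _,_)
open import Data.Sum using (_⊎_; inj₁; inj₂)
open import Relation.Binary.PropositionalEquality
  using (_≡_; refl; sym; trans; cong; cong₂; module ≡-Reasoning)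
import Data.Nat.Solver
import Data.Integer.Solver
import Data.Rational.Solver

open ≡-Reasoning

fromℚᵘ-homo-+ : ∀ a b → fromℚᵘ (a ℚᵘ.+ b) ≡ fromℚᵘ a + fromℚᵘ b
fromℚᵘ-homo-+ a b = ℚP.toℚᵘ-injective (ℚᵘP.≃-trans (ℚP.toℚᵘ-fromℚᵘ (a ℚᵘ.+ b))
  (ℚᵘP.≃-sym (ℚᵘP.≃-trans (ℚP.toℚᵘ-homo-+ (fromℚᵘ a) (fromℚᵘ b))
                          (ℚᵘP.+-cong (ℚP.toℚᵘ-fromℚᵘ a) (ℚP.toℚᵘ-fromℚᵘ b)))))

fromℚᵘ-homo-* : ∀ a b → fromℚᵘ (a ℚᵘ.* b) ≡ fromℚᵘ a * fromℚᵘ b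
fromℚᵘ-homo-* a b = ℚP.toℚᵘ-injective (ℚᵘP.≃-trans (ℚP.toℚᵘ-fromℚᵘ (a ℚᵘ.* b))
  (ℚᵘP.≃-sym (ℚᵘP.≃-trans (ℚP.toℚᵘ-homo-* (fromℚᵘ a) (fromℚᵘ b))
                          (ℚᵘP.*-cong (ℚP.toℚᵘ-fromℚᵘ a) (ℚP.toℚᵘ-fromℚᵘ b)))))

ι-+ : ∀ m n → ι (m +ℕ n) ≡ ι m + ι n
ι-+ m n = trans (ℚP.fromℚᵘ-cong {mkℚᵘ (pos (m +ℕ n)) 0} {mkℚᵘ (pos m) 0 ℚᵘ.+ mkℚᵘ (pos n) 0} (*≡* cross))
                (fromℚᵘ-homo-+ (mkℚᵘ (pos m) 0) (mkℚᵘ (pos n) 0))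
  where
  open Data.Integer.Solver.+-*-Solver
  cross : pos (m +ℕ n) ℤ.* (pos 1 ℤ.* pos 1) ≡ (pos m ℤ.* pos 1 ℤ.+ pos n ℤ.* pos 1) ℤ.* pos 1
  cross = trans (cong (ℤ._* (pos 1 ℤ.* pos 1)) (ℤP.pos-+ m n))
    (solve 2 (λ x y → (x :+ y) :* (con (pos 1) :* con (pos 1)) := (x :* con (pos 1) :+ y :* con (pos 1)) :* con (pos 1))
           refl (pos m) (pos n))

ι-* : ∀ m n → ι (m *ℕ n) ≡ ι m * ι n
ι-* m n = trans (ℚP.fromℚᵘ-cong {mkℚᵘ (pos (m *ℕ n)) 0} {mkℚᵘ (pos m) 0 ℚᵘ.* mkℚᵘ (pos n) 0} (*≡* cross))
                (fromℚᵘ-homo-* (mkℚᵘ (pos m) 0) (mkℚᵘ (pos n) 0))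
  where
  cross : pos (m *ℕ n) ℤ.* pos 1 ≡ (pos m ℤ.* pos n) ℤ.* pos 1
  cross = cong (ℤ._* pos 1) (ℤP.pos-* m n)

ι-inverse : ∀ n → ι (suc n) * (pos 1 / suc n) ≡ 1ℚ
ι-inverse n = trans (sym (fromℚᵘ-homo-* (mkℚᵘ (pos (suc n)) 0) (mkℚᵘ (pos 1) n)))
                    (ℚP.fromℚᵘ-cong {mkℚᵘ (pos (suc n)) 0 ℚᵘ.* mkℚᵘ (pos 1) n} {ℚᵘ.1ℚᵘ} (*≡* cross))
  where
  open Data.Integer.Solver.+-*-Solver
  cross : (pos (suc n) ℤ.* pos 1) ℤ.* pos 1 ≡ pos 1 ℤ.* pos (1 *ℕ suc n)
  cross = trans (solve 1 (λ x → x :* con (pos 1) :* con (pos 1) := con (pos 1) :* x) refl (pos (suc n)))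
                (cong (λ k → pos 1 ℤ.* pos k) (sym (ℕP.*-identityˡ (suc n))))

sgn-+ : ∀ m n → sgn (m +ℕ n) ≡ sgn m * sgn n
sgn-+ zero    n = sym (ℚP.*-identityˡ (sgn n))
sgn-+ (suc m) n = trans (cong -_ (sgn-+ m n)) (ℚP.neg-distribˡ-* (sgn m) (sgn n))

sgn-square : ∀ n → sgn n * sgn n ≡ 1ℚ
sgn-square zero    = refl
sgn-square (suc n) = trans (solve 1 (λ s → (:- s) :* (:- s) := s :* s) refl (sgn n)) (sgn-square n)
  where open Data.Rational.Solver.+-*-Solver

sgn-cancel : ∀ n x → sgn n * (sgn n * x) ≡ x
sgn-cancel n x = begin
  sgn n * (sgn n * x)  ≡⟨ ℚP.*-assoc (sgn n) (sgn n) x ⟨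
  sgn n * sgn n * x    ≡⟨ cong (_* x) (sgn-square n) ⟩
  1ℚ * x               ≡⟨ ℚP.*-identityˡ x ⟩
  x                    ∎

sgn-+-even : ∀ a b → sgn (a +ℕ b +ℕ b) ≡ sgn a
sgn-+-even a b = begin
  sgn (a +ℕ b +ℕ b)        ≡⟨ sgn-+ (a +ℕ b) b ⟩
  sgn (a +ℕ b) * sgn b     ≡⟨ cong (_* sgn b) (sgn-+ a b) ⟩
  sgn a * sgn b * sgn b    ≡⟨ ℚP.*-assoc (sgn a) (sgn b) (sgn b) ⟩
  sgn a * (sgn b * sgn b)  ≡⟨ cong (sgn a *_) (sgn-square b) ⟩
  sgn a * 1ℚ               ≡⟨ ℚP.*-identityʳ (sgn a) ⟩
  sgn a                    ∎

Σ-cong≤ : ∀ n {f g : ℕ → ℚ} → (∀ k → k ≤ℕ n → f k ≡ g k) → Σ≤ n f ≡ Σ≤ n g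
Σ-cong≤ zero    e = e 0 z≤n
Σ-cong≤ (suc n) e = cong₂ _+_ (Σ-cong≤ n (λ k k≤n → e k (ℕP.m≤n⇒m≤1+n k≤n))) (e (suc n) ℕP.≤-refl)

Σ-cong : ∀ n {f g : ℕ → ℚ} → (∀ k → f k ≡ g k) → Σ≤ n f ≡ Σ≤ n g
Σ-cong n e = Σ-cong≤ n (λ k _ → e k)

Σ-+ : ∀ n (f g : ℕ → ℚ) → Σ≤ n (λ k → f k + g k) ≡ Σ≤ n f + Σ≤ n g
Σ-+ zero    f g = refl
Σ-+ (suc n) f g = trans (cong (_+ (f (suc n) + g (suc n))) (Σ-+ n f g))
  (solve 4 (λ a b c d → (a :+ b) :+ (c :+ d) := (a :+ c) :+ (b :+ d)) refl
         (Σ≤ n f) (Σ≤ n g) (f (suc n)) (g (suc n)))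
  where open Data.Rational.Solver.+-*-Solver

Σ-*ˡ : ∀ n c (f : ℕ → ℚ) → Σ≤ n (λ k → c * f k) ≡ c * Σ≤ n f
Σ-*ˡ zero    c f = refl
Σ-*ˡ (suc n) c f = trans (cong (_+ c * f (suc n)) (Σ-*ˡ n c f))
                         (sym (ℚP.*-distribˡ-+ c (Σ≤ n f) (f (suc n))))

Σ-shift : ∀ n (f : ℕ → ℚ) → Σ≤ (suc n) f ≡ f 0 + Σ≤ n (λ k → f (suc k))
Σ-shift zero    f = refl
Σ-shift (suc n) f = trans (cong (_+ f (suc (suc n))) (Σ-shift n f)) (ℚP.+-assoc (f 0) _ _)

Σ-zero : ∀ n (f : ℕ → ℚ) → (∀ k → k ≤ℕ n → f k ≡ 0ℚ) → Σ≤ n f ≡ 0ℚ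
Σ-zero zero    f z = z 0 z≤n
Σ-zero (suc n) f z = trans (cong₂ _+_ (Σ-zero n f (λ k k≤n → z k (ℕP.m≤n⇒m≤1+n k≤n))) (z (suc n) ℕP.≤-refl))
                           (ℚP.+-identityˡ 0ℚ)

Σ-drop-prefix : ∀ q r (f : ℕ → ℚ) → (∀ k → k <ℕ q → f k ≡ 0ℚ) →
                Σ≤ (q +ℕ r) f ≡ Σ≤ r (λ j → f (q +ℕ j))
Σ-drop-prefix zero    r f z = refl
Σ-drop-prefix (suc q) r f z = begin
  Σ≤ (suc (q +ℕ r)) f                      ≡⟨ Σ-shift (q +ℕ r) f ⟩
  f 0 + Σ≤ (q +ℕ r) (λ k → f (suc k))      ≡⟨ cong₂ _+_ (z 0 (s≤s z≤n))
                                                 (Σ-drop-prefix q r (λ k → f (suc k)) (λ k k<q → z (suc k) (s≤s k<q))) ⟩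
  0ℚ + Σ≤ r (λ j → f (suc q +ℕ j))         ≡⟨ ℚP.+-identityˡ _ ⟩
  Σ≤ r (λ j → f (suc q +ℕ j))              ∎

-- The binomial transform (T f)(n) = Σ_{k≤n} C(n,k) f(k)

T : (ℕ → ℚ) → ℕ → ℚ
T f n = Σ≤ n (λ k → ι (n C k) * f k)

T-cong : ∀ n {f g : ℕ → ℚ} → (∀ k → f k ≡ g k) → T f n ≡ T g n
T-cong n e = Σ-cong n (λ k → cong (ι (n C k) *_) (e k))

T-+ : ∀ n (f g : ℕ → ℚ) → T (λ k → f k + g k) n ≡ T f n + T g n
T-+ n f g = trans (Σ-cong n (λ k → ℚP.*-distribˡ-+ (ι (n C k)) (f k) (g k))) (Σ-+ n _ _)

T-*ˡ : ∀ n c (f : ℕ → ℚ) → T (λ k → c * f k) n ≡ c * T f n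
T-*ˡ n c f = trans (Σ-cong n (λ k → swap (ι (n C k)) c (f k))) (Σ-*ˡ n c _)
  where
  open Data.Rational.Solver.+-*-Solver
  swap : ∀ x c y → x * (c * y) ≡ c * (x * y)
  swap = solve 3 (λ x c y → x :* (c :* y) := c :* (x :* y)) refl

-- Peeling off the k = 0 term; the extra term C(n,n+1) f(n+1) of the extended sum vanishes.
T-unfold : ∀ f n → T f n ≡ f 0 + Σ≤ n (λ k → ι (n C suc k) * f (suc k))
T-unfold f n = begin
  T f n                                               ≡⟨ ℚP.+-identityʳ (T f n) ⟨
  T f n + 0ℚ                                          ≡⟨ cong (T f n +_) vanishing ⟨
  Σ≤ (suc n) (λ k → ι (n C k) * f k)                  ≡⟨ Σ-shift n _ ⟩
  ι 1 * f 0 + rest                                    ≡⟨ cong (_+ rest) (ℚP.*-identityˡ (f 0)) ⟩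
  f 0 + rest                                          ∎
  where
  rest : ℚ
  rest = Σ≤ n (λ k → ι (n C suc k) * f (suc k))
  vanishing : ι (n C suc n) * f (suc n) ≡ 0ℚ
  vanishing = trans (cong (λ c → ι c * f (suc n)) (k>n⇒nCk≡0 (ℕP.n<1+n n))) (ℚP.*-zeroˡ (f (suc n)))

-- Pascal's rule C(n+1,k+1) = C(n,k+1) + C(n,k), lifted to the transform.
T-pascal : ∀ f n → T f (suc n) ≡ T f n + T (λ k → f (suc k)) n
T-pascal f n = begin
  T f (suc n)                                            ≡⟨ Σ-shift n _ ⟩
  ι 1 * f 0 + Σ≤ n (λ k → ι (suc n C suc k) * f (suc k)) ≡⟨ cong₂ _+_ (ℚP.*-identityˡ (f 0)) (Σ-cong n pascal) ⟩
  f 0 + Σ≤ n (λ k → Y k + ι (n C k) * f (suc k))         ≡⟨ cong (f 0 +_) (Σ-+ n Y _) ⟩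
  f 0 + (Σ≤ n Y + T f′ n)                                ≡⟨ ℚP.+-assoc (f 0) (Σ≤ n Y) (T f′ n) ⟨
  f 0 + Σ≤ n Y + T f′ n                                  ≡⟨ cong (_+ T f′ n) (T-unfold f n) ⟨
  T f n + T f′ n                                         ∎
  where
  f′ : ℕ → ℚ
  f′ k = f (suc k)
  Y : ℕ → ℚ
  Y k = ι (n C suc k) * f (suc k)
  pascal : ∀ k → ι (suc n C suc k) * f (suc k) ≡ Y k + ι (n C k) * f (suc k)
  pascal k = begin
    ι (suc n C suc k) * f (suc k)                   ≡⟨ cong (λ c → ι c * f (suc k))
                                                         (trans (sym (nCk+nC[k+1]≡[n+1]C[k+1] n k)) (ℕP.+-comm (n C k) _)) ⟩
    ι (n C suc k +ℕ n C k) * f (suc k)              ≡⟨ cong (_* f (suc k)) (ι-+ (n C suc k) (n C k)) ⟩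
    (ι (n C suc k) + ι (n C k)) * f (suc k)         ≡⟨ ℚP.*-distribʳ-+ (f (suc k)) (ι (n C suc k)) (ι (n C k)) ⟩
    Y k + ι (n C k) * f (suc k)                     ∎

T-inversion : ∀ n f → T (λ k → sgn k * T f k) n ≡ sgn n * f n
T-inversion zero    f = trans (ℚP.*-identityˡ _) (ℚP.*-identityˡ _)
T-inversion (suc n) f = begin
  T g (suc n)                                   ≡⟨ T-pascal g n ⟩
  T g n + T (λ k → - sgn k * T f (suc k)) n     ≡⟨ cong (T g n +_) (T-cong n (λ k → cong (λ t → - sgn k * t) (T-pascal f k))) ⟩
  T g n + T (λ k → - sgn k * (T f k + T f′ k)) n ≡⟨ cong (T g n +_) (T-cong n (λ k → split (sgn k) (T f k) (T f′ k))) ⟩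
  T g n + T (λ k → (- 1ℚ) * (g k + g′ k)) n     ≡⟨ cong (T g n +_) (trans (T-*ˡ n (- 1ℚ) _) (cong ((- 1ℚ) *_) (T-+ n g g′))) ⟩
  T g n + (- 1ℚ) * (T g n + T g′ n)             ≡⟨ solve 2 (λ x y → x :+ (:- con 1ℚ) :* (x :+ y) := :- y) refl (T g n) (T g′ n) ⟩
  - T g′ n                                      ≡⟨ cong -_ (T-inversion n f′) ⟩
  - (sgn n * f (suc n))                         ≡⟨ ℚP.neg-distribˡ-* (sgn n) (f (suc n)) ⟩
  sgn (suc n) * f (suc n)                       ∎
  where
  open Data.Rational.Solver.+-*-Solver
  f′ : ℕ → ℚ
  f′ k = f (suc k)
  g g′ : ℕ → ℚ
  g k = sgn k * T f k
  g′ k = sgn k * T f′ k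
  split : ∀ s x y → - s * (x + y) ≡ (- 1ℚ) * (s * x + s * y)
  split = solve 3 (λ s x y → (:- s) :* (x :+ y) := (:- con 1ℚ) :* (s :* x :+ s :* y)) refl

lookup-∷ʳ-last : ∀ {A : Set} n (xs : Vec A n) x → lookup (xs ∷ʳ x) (fromℕ n) ≡ x
lookup-∷ʳ-last zero    []       x = refl
lookup-∷ʳ-last (suc n) (y ∷ xs) x = lookup-∷ʳ-last n xs x

lookup-∷ʳ-inject₁ : ∀ {A : Set} n (xs : Vec A n) x (i : Fin n) → lookup (xs ∷ʳ x) (inject₁ i) ≡ lookup xs i
lookup-∷ʳ-inject₁ (suc n) (y ∷ xs) x Fin.zero    = refl
lookup-∷ʳ-inject₁ (suc n) (y ∷ xs) x (Fin.suc i) = lookup-∷ʳ-inject₁ n xs x i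

last-or-inject₁ : ∀ {n} (i : Fin (suc n)) → i ≡ fromℕ n ⊎ Σ (Fin n) (λ j → i ≡ inject₁ j)
last-or-inject₁ {zero}  Fin.zero    = inj₁ refl
last-or-inject₁ {suc n} Fin.zero    = inj₂ (Fin.zero , refl)
last-or-inject₁ {suc n} (Fin.suc i) with last-or-inject₁ i
... | inj₁ refl         = inj₁ refl
... | inj₂ (j , refl)   = inj₂ (Fin.suc j , refl)

bernTable-lookup : ∀ n (i : Fin n) → lookup (bernTable n) i ≡ B (toℕ i)
bernTable-lookup (suc n) i with last-or-inject₁ i
... | inj₁ refl       = cong B (sym (FinP.toℕ-fromℕ n))
... | inj₂ (j , refl) = begin
  lookup (bernTable n ∷ʳ _) (inject₁ j)  ≡⟨ lookup-∷ʳ-inject₁ n (bernTable n) _ j ⟩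
  lookup (bernTable n) j                 ≡⟨ bernTable-lookup n j ⟩
  B (toℕ j)                              ≡⟨ cong B (FinP.toℕ-inject₁ j) ⟨
  B (toℕ (inject₁ j))                    ∎

ΣFin-toℕ : ∀ m (f : Fin (suc m) → ℚ) (g : ℕ → ℚ) → (∀ i → f i ≡ g (toℕ i)) → ΣFin f ≡ Σ≤ m g
ΣFin-toℕ zero    f g e = trans (ℚP.+-identityʳ (f Fin.zero)) (e Fin.zero)
ΣFin-toℕ (suc m) f g e = trans (cong₂ _+_ (e Fin.zero) (ΣFin-toℕ m _ (λ k → g (suc k)) (λ i → e (Fin.suc i))))
                               (sym (Σ-shift m g))

B-rec : ∀ m → B (suc m) ≡ - ((pos 1 / suc (suc m)) * Σ≤ m (λ k → ι (suc (suc m) C k) * B k))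
B-rec m = trans (lookup-∷ʳ-last (suc m) (bernTable (suc m)) _)
  (cong (λ s → - ((pos 1 / suc (suc m)) * s))
        (ΣFin-toℕ m _ _ (λ i → cong (ι (suc (suc m) C toℕ i) *_) (bernTable-lookup (suc m) i))))

-- The Bernoulli recurrence characterises B

BernoulliRecurrence : (ℕ → ℚ) → Set
BernoulliRecurrence y = ∀ m → Σ≤ (suc m) (λ k → ι (suc (suc m) C k) * y k) ≡ 0ℚ

C-penultimate : ∀ n → suc n C n ≡ suc n
C-penultimate n = begin
  suc n C n              ≡⟨ nCk≡nC[n∸k] (ℕP.n≤1+n n) ⟩
  suc n C (suc n ∸ n)    ≡⟨ cong (suc n C_) (ℕP.m+n∸n≡m 1 n) ⟩
  suc n C 1              ≡⟨ nC1≡n (suc n) ⟩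
  suc n                  ∎

recurrenceHead : (ℕ → ℚ) → ℕ → ℚ
recurrenceHead y m = Σ≤ m (λ k → ι (suc (suc m) C k) * y k)

recurrence-last-term : ∀ y m → Σ≤ (suc m) (λ k → ι (suc (suc m) C k) * y k)
                              ≡ recurrenceHead y m + ι (suc (suc m)) * y (suc m)
recurrence-last-term y m = cong (λ c → recurrenceHead y m + ι c * y (suc m)) (C-penultimate (suc m))

solve-linear : ∀ s a c y → a * c ≡ 1ℚ → s + a * y ≡ 0ℚ → y ≡ - (c * s)
solve-linear s a c y ac≡1 eq = begin
  y                        ≡⟨ ℚP.*-identityˡ y ⟨
  1ℚ * y                   ≡⟨ cong (_* y) ac≡1 ⟨
  a * c * y                ≡⟨ solve 3 (λ a c y → a :* c :* y := :- (c :* (:- (a :* y)))) refl a c y ⟩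
  - (c * (- (a * y)))      ≡⟨ cong (λ t → - (c * t)) (inverseˡ-unique s (a * y) eq) ⟨
  - (c * s)                ∎
  where open Data.Rational.Solver.+-*-Solver

solution-linear : ∀ s a c → a * c ≡ 1ℚ → s + a * (- (c * s)) ≡ 0ℚ
solution-linear s a c ac≡1 = begin
  s + a * (- (c * s))      ≡⟨ solve 3 (λ s a c → s :+ a :* (:- (c :* s)) := s :- a :* c :* s) refl s a c ⟩
  s - a * c * s            ≡⟨ cong (λ t → s - t * s) ac≡1 ⟩
  s - 1ℚ * s               ≡⟨ solve 1 (λ s → s :- con 1ℚ :* s := con 0ℚ) refl s ⟩
  0ℚ                       ∎
  where open Data.Rational.Solver.+-*-Solver

B-recurrence : BernoulliRecurrence B
B-recurrence m = trans (recurrence-last-term B m)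
  (trans (cong (λ b → recurrenceHead B m + ι (suc (suc m)) * b) (B-rec m)) (solution-linear (recurrenceHead B m) (ι (suc (suc m))) _ (ι-inverse (suc m))))

recurrence-unique : ∀ y → BernoulliRecurrence y → y 0 ≡ 1ℚ → ∀ n → y n ≡ B n
recurrence-unique y rec y₀ n = agree n n ℕP.≤-refl
  where
  agree : ∀ n k → k ≤ℕ n → y k ≡ B k
  agree zero    .zero z≤n = y₀
  agree (suc n) k   k≤1+n with ℕP.m≤n⇒m<n∨m≡n k≤1+n
  ... | inj₁ k<1+n = agree n k (ℕP.≤-pred k<1+n)
  ... | inj₂ refl  = begin
    y (suc n)                                              ≡⟨ solve-linear (recurrenceHead y n) (ι (suc (suc n))) c (y (suc n)) (ι-inverse (suc n))
                                                                (trans (sym (recurrence-last-term y n)) (rec n)) ⟩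
    - (c * recurrenceHead y n)                             ≡⟨ cong (λ s → - (c * s))
                                                                (Σ-cong≤ n (λ k k≤n → cong (ι (suc (suc n) C k) *_) (agree n k k≤n))) ⟩
    - (c * recurrenceHead B n)                             ≡⟨ B-rec n ⟨
    B (suc n)                                              ∎
    where
    c : ℚ
    c = pos 1 / suc (suc n)

-- Reflection formula Σ_{k≤n} C(n,k) B_k = (-1)^n B_n, i.e. T B n = (-1)^n B n.
-- The sequence (-1)^k (T B)(k) satisfies the recurrence by binomial inversion.
T-B-reflection : ∀ n → T B n ≡ sgn n * B n
T-B-reflection n = begin
  T B n                  ≡⟨ sgn-cancel n (T B n) ⟨
  sgn n * (sgn n * T B n) ≡⟨ cong (sgn n *_) (recurrence-unique y y-recurrence refl n) ⟩
  sgn n * B n            ∎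
  where
  y : ℕ → ℚ
  y k = sgn k * T B k
  y-recurrence : BernoulliRecurrence y
  y-recurrence m = identityˡ-unique _ (s * b)
    (trans (cong (Σ≤ (suc m) (λ k → ι (suc (suc m) C k) * y k) +_) (sym last-term)) (T-inversion (suc (suc m)) B))
    where
    open Data.Rational.Solver.+-*-Solver
    s b : ℚ
    s = sgn (suc (suc m))
    b = B (suc (suc m))
    last-term : ι (suc (suc m) C suc (suc m)) * y (suc (suc m)) ≡ s * b
    last-term = begin
      ι (suc (suc m) C suc (suc m)) * y (suc (suc m))       ≡⟨ cong (λ c → ι c * (s * (Σ≤ (suc m) (λ k → ι (suc (suc m) C k) * B k) + ι c * b))) (nCn≡1 (suc (suc m))) ⟩
      ι 1 * (s * (Σ≤ (suc m) (λ k → ι (suc (suc m) C k) * B k) + ι 1 * b))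
                                                            ≡⟨ cong (λ t → ι 1 * (s * (t + ι 1 * b))) (B-recurrence m) ⟩
      ι 1 * (s * (0ℚ + ι 1 * b))                            ≡⟨ solve 2 (λ s b → con 1ℚ :* (s :* (con 0ℚ :+ con 1ℚ :* b)) := s :* b) refl s b ⟩
      s * b                                                 ∎

-- Trinomial revision

C-factorial : ∀ n k → k ≤ℕ n → (n C k) *ℕ (k ! *ℕ (n ∸ k) !) ≡ n !
C-factorial n k k≤n = trans (cong (_*ℕ (k ! *ℕ (n ∸ k) !)) (nCk≡n!/k![n-k]! k≤n))
                            (m/n*n≡m {{k !* (n ∸ k) !≢0}} (k![n∸k]!∣n! k≤n))

-- C(q+r, q+j) C(q+j, q) = C(q+r, q) C(r, j): both sides times q! j! (r-j)! equal (q+r)!.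
trinomial-revision : ∀ q r j → j ≤ℕ r →
                     ((q +ℕ r) C (q +ℕ j)) *ℕ ((q +ℕ j) C q) ≡ ((q +ℕ r) C q) *ℕ (r C j)
trinomial-revision q r j j≤r =
  ℕP.*-cancelʳ-≡ _ _ (q ! *ℕ (j ! *ℕ (r ∸ j) !)) {{denominator≢0}} (trans lhs (sym rhs))
  where
  open Data.Nat.Solver.+-*-Solver
  denominator≢0 : NonZero (q ! *ℕ (j ! *ℕ (r ∸ j) !))
  denominator≢0 = m*n≢0 (q !) (j ! *ℕ (r ∸ j) !) {{q !≢0}} {{j !* (r ∸ j) !≢0}}
  outer inner first second : ℕ
  outer  = (q +ℕ r) C (q +ℕ j)
  inner  = (q +ℕ j) C q
  first  = (q +ℕ r) C q
  second = r C j
  outer-fact : outer *ℕ ((q +ℕ j) ! *ℕ (r ∸ j) !) ≡ (q +ℕ r) !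
  outer-fact = trans (cong (λ t → outer *ℕ ((q +ℕ j) ! *ℕ t !)) (sym (ℕP.[m+n]∸[m+o]≡n∸o q r j)))
                     (C-factorial (q +ℕ r) (q +ℕ j) (ℕP.+-monoʳ-≤ q j≤r))
  inner-fact : inner *ℕ (q ! *ℕ j !) ≡ (q +ℕ j) !
  inner-fact = trans (cong (λ t → inner *ℕ (q ! *ℕ t !)) (sym (ℕP.m+n∸m≡n q j)))
                     (C-factorial (q +ℕ j) q (ℕP.m≤m+n q j))
  first-fact : first *ℕ (q ! *ℕ r !) ≡ (q +ℕ r) !
  first-fact = trans (cong (λ t → first *ℕ (q ! *ℕ t !)) (sym (ℕP.m+n∸m≡n q r)))
                     (C-factorial (q +ℕ r) q (ℕP.m≤m+n q r))
  lhs : outer *ℕ inner *ℕ (q ! *ℕ (j ! *ℕ (r ∸ j) !)) ≡ (q +ℕ r) !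
  lhs = begin
    outer *ℕ inner *ℕ (q ! *ℕ (j ! *ℕ (r ∸ j) !))
      ≡⟨ solve 5 (λ a b x y z → a :* b :* (x :* (y :* z)) := a :* (b :* (x :* y) :* z))
               refl outer inner (q !) (j !) ((r ∸ j) !) ⟩
    outer *ℕ (inner *ℕ (q ! *ℕ j !) *ℕ (r ∸ j) !)
      ≡⟨ cong (λ t → outer *ℕ (t *ℕ (r ∸ j) !)) inner-fact ⟩
    outer *ℕ ((q +ℕ j) ! *ℕ (r ∸ j) !)
      ≡⟨ outer-fact ⟩
    (q +ℕ r) !
      ∎
  rhs : first *ℕ second *ℕ (q ! *ℕ (j ! *ℕ (r ∸ j) !)) ≡ (q +ℕ r) !
  rhs = begin
    first *ℕ second *ℕ (q ! *ℕ (j ! *ℕ (r ∸ j) !))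
      ≡⟨ solve 5 (λ c d x y z → c :* d :* (x :* (y :* z)) := c :* (x :* (d :* (y :* z))))
               refl first second (q !) (j !) ((r ∸ j) !) ⟩
    first *ℕ (q ! *ℕ (second *ℕ (j ! *ℕ (r ∸ j) !)))
      ≡⟨ cong (λ t → first *ℕ (q ! *ℕ t)) (C-factorial r j j≤r) ⟩
    first *ℕ (q ! *ℕ r !)
      ≡⟨ first-fact ⟩
    (q +ℕ r) !
      ∎

-- The sequence h_q(j) = C(j,q) B_{j-q} is reflected by T

binomBernoulli : ℕ → ℕ → ℚ
binomBernoulli q j = ι (j C q) * B (j ∸ q)

binomBernoulli-below : ∀ q j → j <ℕ q → binomBernoulli q j ≡ 0ℚ
binomBernoulli-below q j j<q = trans (cong (λ c → ι c * B (j ∸ q)) (k>n⇒nCk≡0 j<q)) (ℚP.*-zeroˡ (B (j ∸ q)))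

-- For a = q + r the terms k < q vanish, and trinomial revision reduces T h_q to C(q+r,q) T B r.
T-binomBernoulli-above : ∀ q r → T (binomBernoulli q) (q +ℕ r) ≡ sgn (q +ℕ r +ℕ q) * binomBernoulli q (q +ℕ r)
T-binomBernoulli-above q r = begin
  T (binomBernoulli q) (q +ℕ r)
    ≡⟨ Σ-drop-prefix q r _ (λ k k<q → trans (cong (ι ((q +ℕ r) C k) *_) (binomBernoulli-below q k k<q))
                                            (ℚP.*-zeroʳ (ι ((q +ℕ r) C k)))) ⟩
  Σ≤ r (λ j → ι ((q +ℕ r) C (q +ℕ j)) * binomBernoulli q (q +ℕ j))
    ≡⟨ Σ-cong≤ r revise ⟩
  Σ≤ r (λ j → c * (ι (r C j) * B j))
    ≡⟨ Σ-*ˡ r c _ ⟩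
  c * T B r
    ≡⟨ cong (c *_) (T-B-reflection r) ⟩
  c * (sgn r * B r)
    ≡⟨ ℚP.*-assoc c (sgn r) (B r) ⟨
  c * sgn r * B r
    ≡⟨ cong (_* B r) (ℚP.*-comm c (sgn r)) ⟩
  sgn r * c * B r
    ≡⟨ ℚP.*-assoc (sgn r) c (B r) ⟩
  sgn r * (c * B r)
    ≡⟨ cong₂ (λ s t → s * (c * B t)) sign (sym (ℕP.m+n∸m≡n q r)) ⟩
  sgn (q +ℕ r +ℕ q) * binomBernoulli q (q +ℕ r)
    ∎
  where
  c : ℚ
  c = ι ((q +ℕ r) C q)
  sign : sgn r ≡ sgn (q +ℕ r +ℕ q)
  sign = trans (sym (sgn-+-even r q)) (cong (λ t → sgn (t +ℕ q)) (ℕP.+-comm r q))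
  revise : ∀ j → j ≤ℕ r → ι ((q +ℕ r) C (q +ℕ j)) * binomBernoulli q (q +ℕ j) ≡ c * (ι (r C j) * B j)
  revise j j≤r = begin
    ι ((q +ℕ r) C (q +ℕ j)) * (ι ((q +ℕ j) C q) * B (q +ℕ j ∸ q))
      ≡⟨ ℚP.*-assoc (ι ((q +ℕ r) C (q +ℕ j))) _ _ ⟨
    ι ((q +ℕ r) C (q +ℕ j)) * ι ((q +ℕ j) C q) * B (q +ℕ j ∸ q)
      ≡⟨ cong₂ _*_ (sym (ι-* ((q +ℕ r) C (q +ℕ j)) ((q +ℕ j) C q))) (cong B (ℕP.m+n∸m≡n q j)) ⟩
    ι (((q +ℕ r) C (q +ℕ j)) *ℕ ((q +ℕ j) C q)) * B j
      ≡⟨ cong (λ t → ι t * B j) (trinomial-revision q r j j≤r) ⟩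
    ι (((q +ℕ r) C q) *ℕ (r C j)) * B j
      ≡⟨ cong (_* B j) (ι-* ((q +ℕ r) C q) (r C j)) ⟩
    c * ι (r C j) * B j
      ≡⟨ ℚP.*-assoc c (ι (r C j)) (B j) ⟩
    c * (ι (r C j) * B j)
      ∎

T-binomBernoulli : ∀ q a → T (binomBernoulli q) a ≡ sgn (a +ℕ q) * binomBernoulli q a
T-binomBernoulli q a with ℕP.<-≤-connex a q
... | inj₁ a<q = begin
  T (binomBernoulli q) a                     ≡⟨ Σ-zero a _ (λ k k≤a → vanish k (ℕP.≤-<-trans k≤a a<q)) ⟩
  0ℚ                                         ≡⟨ ℚP.*-zeroʳ (sgn (a +ℕ q)) ⟨
  sgn (a +ℕ q) * 0ℚ                          ≡⟨ cong (sgn (a +ℕ q) *_) (binomBernoulli-below q a a<q) ⟨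
  sgn (a +ℕ q) * binomBernoulli q a          ∎
  where
  vanish : ∀ k → k <ℕ q → ι (a C k) * binomBernoulli q k ≡ 0ℚ
  vanish k k<q = trans (cong (ι (a C k) *_) (binomBernoulli-below q k k<q)) (ℚP.*-zeroʳ (ι (a C k)))
... | inj₂ q≤a with ℕP.m≤n⇒∃[o]m+o≡n q≤a
...   | r , refl = T-binomBernoulli-above q r

-- Symmetry of shifted binomial transforms

shiftedT : (ℕ → ℚ) → ℕ → ℕ → ℚ
shiftedT h a b = T (λ k → h (a +ℕ k)) b

shiftedT-pascal : ∀ h a b → shiftedT h a (suc b) ≡ shiftedT h a b + shiftedT h (suc a) b
shiftedT-pascal h a b = trans (T-pascal (λ k → h (a +ℕ k)) b)
  (cong (shiftedT h a b +_) (T-cong b (λ k → cong h (ℕP.+-suc a k))))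

shiftedT-symmetry : ∀ p h → (∀ a → T h a ≡ sgn (a +ℕ p) * h a) →
                    ∀ b a → shiftedT h a b ≡ sgn (a +ℕ b +ℕ p) * shiftedT h b a
shiftedT-symmetry p h reflected zero a = begin
  ι 1 * h (a +ℕ 0)                       ≡⟨ trans (ℚP.*-identityˡ _) (cong h (ℕP.+-identityʳ a)) ⟩
  h a                                    ≡⟨ sgn-cancel (a +ℕ p) (h a) ⟨
  sgn (a +ℕ p) * (sgn (a +ℕ p) * h a)    ≡⟨ cong₂ _*_ (cong (λ t → sgn (t +ℕ p)) (sym (ℕP.+-identityʳ a)))
                                                      (sym (reflected a)) ⟩
  sgn (a +ℕ 0 +ℕ p) * T h a              ∎
shiftedT-symmetry p h reflected (suc b) a = begin
  shiftedT h a (suc b)                   ≡⟨ shiftedT-pascal h a b ⟩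
  shiftedT h a b + shiftedT h (suc a) b  ≡⟨ cong₂ _+_ (shiftedT-symmetry p h reflected b a)
                                                      (shiftedT-symmetry p h reflected b (suc a)) ⟩
  s * P + (- s) * shiftedT h b (suc a)   ≡⟨ cong (λ t → s * P + (- s) * t) (shiftedT-pascal h b a) ⟩
  s * P + (- s) * (P + Q)                ≡⟨ solve 3 (λ s p q → s :* p :+ (:- s) :* (p :+ q) := (:- s) :* q) refl s P Q ⟩
  (- s) * Q                              ≡⟨ cong (λ t → sgn (t +ℕ p) * Q) (sym (ℕP.+-suc a b)) ⟩
  sgn (a +ℕ suc b +ℕ p) * Q              ∎
  where
  open Data.Rational.Solver.+-*-Solver
  s P Q : ℚ
  s = sgn (a +ℕ b +ℕ p)
  P = shiftedT h b a
  Q = shiftedT h (suc b) a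

sum-as-shiftedT : ∀ m n q →
  Σ≤ (m +ℕ q) (λ k → ι ((m +ℕ q) C k) * ι ((n +ℕ q +ℕ k) C q) * B (n +ℕ k))
    ≡ shiftedT (binomBernoulli q) (n +ℕ q) (m +ℕ q)
sum-as-shiftedT m n q = Σ-cong (m +ℕ q) (λ k →
  trans (ℚP.*-assoc (ι ((m +ℕ q) C k)) _ _)
        (cong (λ t → ι ((m +ℕ q) C k) * (ι ((n +ℕ q +ℕ k) C q) * B t)) (sym (index k))))
  where
  open Data.Nat.Solver.+-*-Solver
  index : ∀ k → n +ℕ q +ℕ k ∸ q ≡ n +ℕ k
  index k = trans (cong (_∸ q) (solve 3 (λ n q k → n :+ q :+ k := (n :+ k) :+ q) refl n q k))
                  (ℕP.m+n∸n≡m (n +ℕ k) q)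

theorem-sign : ∀ m n q → sgn (n +ℕ q +ℕ (m +ℕ q) +ℕ q) ≡ sgn m * sgn (n +ℕ q)
theorem-sign m n q = begin
  sgn (n +ℕ q +ℕ (m +ℕ q) +ℕ q)   ≡⟨ cong sgn (solve 3 (λ m n q → n :+ q :+ (m :+ q) :+ q := m :+ (n :+ q) :+ q :+ q)
                                                       refl m n q) ⟩
  sgn (m +ℕ (n +ℕ q) +ℕ q +ℕ q)   ≡⟨ sgn-+-even (m +ℕ (n +ℕ q)) q ⟩
  sgn (m +ℕ (n +ℕ q))             ≡⟨ sgn-+ m (n +ℕ q) ⟩
  sgn m * sgn (n +ℕ q)            ∎
  where open Data.Nat.Solver.+-*-Solver

mainTheorem1 : (m n q : ℕ) →
    sgn m * Σ≤ (m +ℕ q) (λ k → ι ((m +ℕ q) C k) * ι ((n +ℕ q +ℕ k) C q) * B (n +ℕ k))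
    - sgn (n +ℕ q) * Σ≤ (n +ℕ q) (λ k → ι ((n +ℕ q) C k) * ι ((m +ℕ q +ℕ k) C q) * B (m +ℕ k))
    ≡ 0ℚ
mainTheorem1 m n q = begin
  sgn m * _ - sgn (n +ℕ q) * _
    ≡⟨ cong₂ (λ u v → sgn m * u - sgn (n +ℕ q) * v) (sum-as-shiftedT m n q) (sum-as-shiftedT n m q) ⟩
  sgn m * shiftedT h (n +ℕ q) (m +ℕ q) - sgn (n +ℕ q) * X
    ≡⟨ cong (λ u → sgn m * u - sgn (n +ℕ q) * X)
            (shiftedT-symmetry q h (T-binomBernoulli q) (m +ℕ q) (n +ℕ q)) ⟩
  sgn m * (sgn (n +ℕ q +ℕ (m +ℕ q) +ℕ q) * X) - sgn (n +ℕ q) * X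
    ≡⟨ cong (λ σ → sgn m * (σ * X) - sgn (n +ℕ q) * X) (theorem-sign m n q) ⟩
  sgn m * (sgn m * sgn (n +ℕ q) * X) - sgn (n +ℕ q) * X
    ≡⟨ cong (λ u → sgn m * u - sgn (n +ℕ q) * X) (ℚP.*-assoc (sgn m) (sgn (n +ℕ q)) X) ⟩
  sgn m * (sgn m * (sgn (n +ℕ q) * X)) - sgn (n +ℕ q) * X
    ≡⟨ cong (_- sgn (n +ℕ q) * X) (sgn-cancel m (sgn (n +ℕ q) * X)) ⟩
  sgn (n +ℕ q) * X - sgn (n +ℕ q) * X
    ≡⟨ ℚP.+-inverseʳ (sgn (n +ℕ q) * X) ⟩
  0ℚ
    ∎
  where
  h : ℕ → ℚ
  h = binomBernoulli q
  X : ℚ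
  X = shiftedT h (m +ℕ q) (n +ℕ q)
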